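{- Let $l\geq 2$ be an even integer and fix a symmetric sequence of positive integers $a_1,a_2,\dots,a_{l-1}$ (i.e. $a_i=a_{l-i}$). Define positive integers $E,F,G$ by $$\begin{bmatrix} E & F\\ F & G\end{bmatrix}=\prod_{i=1}^{l-1}\begin{bmatrix} a_i & 1\\ 1 & 0\end{bmatrix},$$ so that $F^2-EG=(-1)^l=1$, and assume that $F$ or $G$ is even. Consider the two cases: (1) $F$ is even and $E,G$ are odd, or $E,F$ are odd and $G$ is even; in this case put $a=E^2$, $b=2F-EFG$, $c=(F^2/4-1)G^2$; (2) $F$ is odd and $E,G$ are even; in this case put $a=E^2/4$, $b=F-EFG/2$, $c=(F^2/4-1)G^2$. Let $D(t)=at^2+bt+c$ and $t_0=\lfloor FG/E\rfloor+1$ (by Friesen's theorem, the squarefree integers $D>1$ with $\sqrt{D}=[a_0,\overline{a_1,\ldots,a_{l-1},2a_0}]$ are exactly such values $D=D(t)$ with $t\geq t_0$, where $a_0=(Et-FG)/2$). Further let (1) $E_{\pm}=\gcd(F\pm 1, E)$, $G_{\pm}=\gcd(F\pm 1, G)$ in case (1), and (2) $2E_{\pm}=\gcd(F\pm 1, E)$, $2G_{\pm}=\gcd(F\pm 1, G)$ in case (2). Then we have the following factorizations into products of integers: (1) $D=D(t)=\left(E_+^2t-G_-^2(F+2)/2\right)\left(E_-^2t-G_+^2(F-2)/2\right)$ in case (1), (2) $D=D(t)=\left(E_+^2t-G_-^2(F+2)\right)\left(E_-^2t-G_+^2(F-2)\right)$ in case (2). When $t\geq t_0$, both parentheses in the factorization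 are positive integers. Moreover, if $D=D(t)$ is prime, then $t=t_0$ attains the smallest possible value.
   Context: For a non-square positive integer $D$, $\sqrt{D}=[a_0,\overline{a_1,\ldots,a_l}]$ has period length $l$, with $a_l=2a_0$ and $a_j=a_{l-j}$ for $1\le j\le l-1$. The entries satisfy $E=q_{l-1}(a_1,\dots,a_{l-1})$, $F=q_{l-2}(a_1,\dots,a_{l-2})$, $G=q_{l-3}(a_2,\dots,a_{l-2})$, where $q_{ -1}=0$, $q_0=1$, $q_n(x_1,\dots,x_n)=x_nq_{n-1}(x_1,\dots,x_{n-1})+q_{n-2}(x_1,\dots,x_{n-2})$. -}

module Defs where

open import Function using (_∘_)
open import Data.Fin using (Fin; zero; suc)
open import Data.Nat as ℕ using (ℕ; zero; suc)
import Data.Nat.DivMod as ℕD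
open import Data.Nat.GCD using (gcd)
open import Data.Integer as ℤ using (ℤ; +_)
open import Data.Integer.DivMod using (_/_)

-- 2×2 matrices over ℕ:  mat e f f' g  is  [[e , f] , [f' , g]]

record M2 : Set where
  constructor mat
  field
    e f f' g : ℕ

_⊗_ : M2 → M2 → M2
mat a b c d ⊗ mat a' b' c' d' =
  mat (a ℕ.* a' ℕ.+ b ℕ.* c') (a ℕ.* b' ℕ.+ b ℕ.* d')
      (c ℕ.* a' ℕ.+ d ℕ.* c') (c ℕ.* b' ℕ.+ d ℕ.* d')

I₂ : M2
I₂ = mat 1 0 0 1

Aₘ : ℕ → M2
Aₘ x = mat x 1 1 0

-- ordered product  A(a₁) A(a₂) ⋯ A(aₙ)  (index 0 of Fin n is a₁)
prodM : ∀ {n} → (Fin n → ℕ) → M2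
prodM {zero}  a = I₂
prodM {suc n} a = Aₘ (a zero) ⊗ prodM (a ∘ suc)

-- floor division on ℕ (the divisor E is always ≥ 1 in the theorem;
-- the value for divisor 0 is an irrelevant convention)

fdiv : ℕ → ℕ → ℕ
fdiv m zero    = 0
fdiv m (suc n) = m ℕD./ suc n

module _ (E F G : ℕ) where

  -- c = (F²/4 − 1) G² = (F² − 4) G² / 4   (exact division in both cases)
  cc : ℤ
  cc = ((+ F ℤ.* + F ℤ.- + 4) ℤ.* (+ G ℤ.* + G)) / (+ 4)

  t₀ : ℤ
  t₀ = + (fdiv (F ℕ.* G) E) ℤ.+ + 1

  a₁ b₁ : ℤ
  a₁ = + (E ℕ.* E)
  b₁ = + (2 ℕ.* F) ℤ.- + (E ℕ.* F ℕ.* G)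

  D₁ : ℤ → ℤ
  D₁ t = a₁ ℤ.* t ℤ.* t ℤ.+ b₁ ℤ.* t ℤ.+ cc

  E₊₁ E₋₁ G₊₁ G₋₁ : ℕ
  E₊₁ = gcd (F ℕ.+ 1) E
  E₋₁ = gcd (F ℕ.∸ 1) E
  G₊₁ = gcd (F ℕ.+ 1) G
  G₋₁ = gcd (F ℕ.∸ 1) G

  N₁ N₂ : ℤ
  N₁ = + (G₋₁ ℕ.* G₋₁) ℤ.* (+ F ℤ.+ + 2)
  N₂ = + (G₊₁ ℕ.* G₊₁) ℤ.* (+ F ℤ.- + 2)

  P₁ P₂ : ℤ → ℤ
  P₁ t = + (E₊₁ ℕ.* E₊₁) ℤ.* t ℤ.- (N₁ / (+ 2))
  P₂ t = + (E₋₁ ℕ.* E₋₁) ℤ.* t ℤ.- (N₂ / (+ 2))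

  a₂ b₂ : ℤ
  a₂ = + ((E ℕ.* E) ℕD./ 4)
  b₂ = + F ℤ.- + ((E ℕ.* F ℕ.* G) ℕD./ 2)

  D₂ : ℤ → ℤ
  D₂ t = a₂ ℤ.* t ℤ.* t ℤ.+ b₂ ℤ.* t ℤ.+ cc

  E₊₂ E₋₂ G₊₂ G₋₂ : ℕ
  E₊₂ = gcd (F ℕ.+ 1) E ℕD./ 2
  E₋₂ = gcd (F ℕ.∸ 1) E ℕD./ 2
  G₊₂ = gcd (F ℕ.+ 1) G ℕD./ 2
  G₋₂ = gcd (F ℕ.∸ 1) G ℕD./ 2

  Q₁ Q₂ : ℤ → ℤ
  Q₁ t = + (E₊₂ ℕ.* E₊₂) ℤ.* t ℤ.- + (G₋₂ ℕ.* G₋₂) ℤ.* (+ F ℤ.+ + 2)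
  Q₂ t = + (E₋₂ ℕ.* E₋₂) ℤ.* t ℤ.- + (G₊₂ ℕ.* G₊₂) ℤ.* (+ F ℤ.- + 2)

{-# OPTIONS --safe #-}
module Submission where

-- Since the period is a palindrome of odd length l − 1, the product matrix is symmetric with
-- determinant −1, so EG = (F + 1)(F − 1).  The four-number theorem splits this as F + 1 = κpr,
-- F − 1 = κqs, E = κpq, G = κrs with gcd(p, s) = gcd(r, q) = 1, where κ = 1 in case (1) and κ = 2
-- in case (2); hence E₊, E₋, G₊, G₋ are p, q, r, s, and D(t) = (p²t − w₁)(q²t − w₂) with
-- 2w₁ = κs²(F + 2), 2w₂ = κr²(F − 2) is a polynomial identity.  For t ≥ t₀ write tE = FG + δ
-- with δ ≥ 1; then 2κq(p²t − w₁) = 2pδ + (a non-negative term), and symmetrically for the other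
-- factor.  So both factors are positive, and if one of them is 1 then δ ≤ E, which forces t = t₀.

open import Defs
open import Data.Fin using (Fin; opposite)
open import Data.Nat as ℕ using (ℕ)
open import Data.Nat.Divisibility using (_∣_)
open import Data.Nat.Primality using (Prime)
open import Data.Integer as ℤ using (ℤ; +_)
import Data.Integer.Divisibility as ℤD
open import Data.Product using (_×_; _,_)
open import Data.Sum using (_⊎_; inj₁; inj₂)
open import Relation.Nullary using (¬_)
open import Relation.Binary.PropositionalEquality using (_≡_)

module MatrixProducts where

  open import Function using (_∘_)
  open import Data.Fin using (zero; suc; inject₁; fromℕ)
  open import Data.Nat using (zero; suc; _+_; _*_; _∸_)
  import Data.Nat.Properties as ℕ
  open import Data.Nat.Divisibility using (divides)
  open import Data.Nat.Tactic.RingSolver using (solve-∀)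
  open import Relation.Binary.PropositionalEquality

  transpose : M2 → M2
  transpose (mat e f f' g) = mat e f' f g

  mat-cong : ∀ {e f f' g e₁ f₁ f₁' g₁} →
             e ≡ e₁ → f ≡ f₁ → f' ≡ f₁' → g ≡ g₁ → mat e f f' g ≡ mat e₁ f₁ f₁' g₁
  mat-cong refl refl refl refl = refl

  ⊗-assoc : ∀ A B C → (A ⊗ B) ⊗ C ≡ A ⊗ (B ⊗ C)
  ⊗-assoc (mat a b c d) (mat a' b' c' d') (mat x y z w) =
    mat-cong (entry a b a' b' c' d' x z) (entry a b a' b' c' d' y w)
             (entry c d a' b' c' d' x z) (entry c d a' b' c' d' y w)
    where
    entry : ∀ a b a' b' c' d' x z → (a * a' + b * c') * x + (a * b' + b * d') * z
                                  ≡ a * (a' * x + b' * z) + b * (c' * x + d' * z)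
    entry = solve-∀

  transpose-⊗ : ∀ A B → transpose (A ⊗ B) ≡ transpose B ⊗ transpose A
  transpose-⊗ (mat a b c d) (mat a' b' c' d') =
    mat-cong (entry a b a' c') (entry c d a' c') (entry a b b' d') (entry c d b' d')
    where
    entry : ∀ a b a' c' → a * a' + b * c' ≡ a' * a + c' * b
    entry = solve-∀

  ⊗-identityʳ : ∀ A → A ⊗ I₂ ≡ A
  ⊗-identityʳ (mat a b c d) = mat-cong (left a b) (right a b) (left c d) (right c d)
    where
    left : ∀ a b → a * 1 + b * 0 ≡ a
    left = solve-∀
    right : ∀ a b → a * 0 + b * 1 ≡ b
    right = solve-∀

  ⊗-identityˡ : ∀ A → I₂ ⊗ A ≡ A
  ⊗-identityˡ (mat a b c d) = mat-cong (top a c) (top b d) (bottom a c) (bottom b d)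
    where
    top : ∀ a c → 1 * a + 0 * c ≡ a
    top = solve-∀
    bottom : ∀ a c → 0 * a + 1 * c ≡ c
    bottom = solve-∀

  prodM-cong : ∀ {n} {a b : Fin n → ℕ} → (∀ i → a i ≡ b i) → prodM a ≡ prodM b
  prodM-cong {zero}  a≗b = refl
  prodM-cong {suc n} a≗b = cong₂ (λ x M → Aₘ x ⊗ M) (a≗b zero) (prodM-cong (a≗b ∘ suc))

  prodM-snoc : ∀ n (a : Fin (suc n) → ℕ) → prodM a ≡ prodM (a ∘ inject₁) ⊗ Aₘ (a (fromℕ n))
  prodM-snoc zero    a = trans (⊗-identityʳ _) (sym (⊗-identityˡ _))
  prodM-snoc (suc n) a = trans (cong (Aₘ (a zero) ⊗_) (prodM-snoc n (a ∘ suc)))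
                               (sym (⊗-assoc (Aₘ (a zero)) _ _))

  prodM-reverse : ∀ n (a : Fin n → ℕ) → prodM (a ∘ opposite) ≡ transpose (prodM a)
  prodM-reverse zero    a = refl
  prodM-reverse (suc n) a = begin
    Aₘ (a (fromℕ n)) ⊗ prodM (a ∘ inject₁ ∘ opposite)  ≡⟨ cong (Aₘ (a (fromℕ n)) ⊗_) (prodM-reverse n (a ∘ inject₁)) ⟩
    Aₘ (a (fromℕ n)) ⊗ transpose (prodM (a ∘ inject₁)) ≡⟨ sym (transpose-⊗ (prodM (a ∘ inject₁)) (Aₘ (a (fromℕ n)))) ⟩
    transpose (prodM (a ∘ inject₁) ⊗ Aₘ (a (fromℕ n))) ≡⟨ cong transpose (sym (prodM-snoc n a)) ⟩
    transpose (prodM a)                                ∎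
    where open ≡-Reasoning

  palindrome⇒f≡f' : ∀ n (a : Fin n → ℕ) → (∀ i → a i ≡ a (opposite i)) →
                    M2.f (prodM a) ≡ M2.f' (prodM a)
  palindrome⇒f≡f' n a a≗a∘opposite =
    cong M2.f (trans (prodM-cong a≗a∘opposite) (prodM-reverse n a))

  det-Aₘ⊗ : ∀ x M u v → M2.e M * M2.g M + u ≡ M2.f M * M2.f' M + v →
            M2.e (Aₘ x ⊗ M) * M2.g (Aₘ x ⊗ M) + v ≡ M2.f (Aₘ x ⊗ M) * M2.f' (Aₘ x ⊗ M) + u
  det-Aₘ⊗ x (mat e f f' g) u v det = begin
    (x * e + 1 * f') * (1 * f + 0 * g) + v ≡⟨ expand x e f f' g v ⟩
    x * e * f + (f * f' + v)               ≡⟨ cong (λ y → x * e * f + y) (sym det) ⟩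
    x * e * f + (e * g + u)                ≡⟨ collect x e f f' g u ⟩
    (x * f + 1 * g) * (1 * e + 0 * f') + u ∎
    where
    open ≡-Reasoning
    expand : ∀ x e f f' g v → (x * e + 1 * f') * (1 * f + 0 * g) + v ≡ x * e * f + (f * f' + v)
    expand = solve-∀
    collect : ∀ x e f f' g u → x * e * f + (e * g + u) ≡ (x * f + 1 * g) * (1 * e + 0 * f') + u
    collect = solve-∀

  -- det (prodM a) = (−1) ^ length, with both sides shifted to avoid truncated subtraction
  det-prodM-even : ∀ k (a : Fin (k * 2) → ℕ) →
                   M2.e (prodM a) * M2.g (prodM a) + 0 ≡ M2.f (prodM a) * M2.f' (prodM a) + 1
  det-prodM-odd  : ∀ k (a : Fin (suc (k * 2)) → ℕ) →
                   M2.e (prodM a) * M2.g (prodM a) + 1 ≡ M2.f (prodM a) * M2.f' (prodM a) + 0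
  det-prodM-even zero    a = refl
  det-prodM-even (suc k) a = det-Aₘ⊗ (a zero) _ 1 0 (det-prodM-odd k (a ∘ suc))
  det-prodM-odd  k       a = det-Aₘ⊗ (a zero) _ 0 1 (det-prodM-even k (a ∘ suc))

  prodM-e-positive : ∀ n (a : Fin n → ℕ) → (∀ i → 1 ℕ.≤ a i) → 1 ℕ.≤ M2.e (prodM a)
  prodM-e-positive zero    a a≥1 = ℕ.≤-refl
  prodM-e-positive (suc n) a a≥1 =
    ℕ.≤-trans (ℕ.*-mono-≤ (a≥1 zero) (prodM-e-positive n (a ∘ suc) (a≥1 ∘ suc))) (ℕ.m≤m+n _ _)

  palindrome-det : ∀ l → 2 ℕ.≤ l → 2 ∣ l → (a : Fin (l ∸ 1) → ℕ) → (∀ i → a i ≡ a (opposite i)) →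
                   M2.e (prodM a) * M2.g (prodM a) + 1 ≡ M2.f (prodM a) * M2.f (prodM a)
  palindrome-det l 2≤l (divides zero refl) a _ with 2≤l
  ... | ()
  palindrome-det _ _ (divides (suc k) refl) a a-palindrome = begin
    e * g + 1  ≡⟨ det-prodM-odd k a ⟩
    f * f' + 0 ≡⟨ ℕ.+-identityʳ (f * f') ⟩
    f * f'     ≡⟨ cong (f *_) (sym (palindrome⇒f≡f' _ a a-palindrome)) ⟩
    f * f      ∎
    where
    open ≡-Reasoning
    open M2 (prodM a)

module Splittings where

  open import Data.Nat using (zero; suc; _+_; _*_; _∸_; s≤s; NonZero; ≢-nonZero; ≢-nonZero⁻¹; >-nonZero)
  import Data.Nat.Properties as ℕ
  open import Data.Nat.Properties using (m*n≢0⇒m≢0; m*n≢0⇒n≢0)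
  open import Data.Nat.Tactic.RingSolver using (solve-∀)
  open import Data.Nat.Divisibility
    using (divides; quotient; m∣n⇒n≡m*quotient; _∣0; ∣m⇒∣m*n; ∣n⇒∣m*n; ∣m+n∣m⇒∣n; ∣1⇒≡1; m%n≡0⇒n∣m)
  open import Data.Nat.DivMod using (_/_; _%_; m*[n/m]≡n; m≡m%n+[m/n]*n; m%n<n)
  open import Data.Nat.GCD using (gcd; gcd[m,n]∣m; gcd[m,n]∣n; gcd[m,n]≢0; c*gcd[m,n]≡gcd[cm,cn])
  open import Data.Nat.Coprimality using (Coprime; coprime-/gcd; coprime-divisor; coprime⇒gcd≡1)
    renaming (sym to ⊥-sym)
  open import Data.Nat.Primality using (prime⇒irreducible; prime[2]; euclidsLemma)
  open import Data.Product using (Σ)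
  open import Data.Empty using (⊥-elim)
  open import Relation.Binary.PropositionalEquality

  record FourNumber (A B C D : ℕ) : Set where
    field
      p q r s : ℕ
      A≡pr : A ≡ p * r
      B≡qs : B ≡ q * s
      C≡pq : C ≡ p * q
      D≡rs : D ≡ r * s
      r⊥q  : Coprime r q

  fourNumber : ∀ A B C D .{{_ : NonZero A}} .{{_ : NonZero C}} → A * B ≡ C * D → FourNumber A B C D
  fourNumber A B C D AB≡CD = record
    { p = g ; q = q ; r = r ; s = quotient q∣B
    ; A≡pr = A≡gr ; B≡qs = B≡qs ; C≡pq = C≡gq ; D≡rs = D≡rs ; r⊥q = coprime-/gcd A C }
    where
    g r q : ℕ
    g = gcd A C
    instance
      g≢0 : NonZero g
      g≢0 = ≢-nonZero (gcd[m,n]≢0 A C (inj₁ (≢-nonZero⁻¹ A)))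
    r = A / g
    q = C / g
    A≡gr : A ≡ g * r
    A≡gr = sym (m*[n/m]≡n (gcd[m,n]∣m A C))
    C≡gq : C ≡ g * q
    C≡gq = sym (m*[n/m]≡n (gcd[m,n]∣n A C))
    instance
      q≢0 : NonZero q
      q≢0 = ≢-nonZero λ q≡0 → ≢-nonZero⁻¹ C (trans C≡gq (trans (cong (g *_) q≡0) (ℕ.*-zeroʳ g)))
    rB≡qD : r * B ≡ q * D
    rB≡qD = ℕ.*-cancelˡ-≡ (r * B) (q * D) g (begin
      g * (r * B) ≡⟨ sym (ℕ.*-assoc g r B) ⟩
      g * r * B   ≡⟨ cong (_* B) (sym A≡gr) ⟩
      A * B       ≡⟨ AB≡CD ⟩
      C * D       ≡⟨ cong (_* D) C≡gq ⟩
      g * q * D   ≡⟨ ℕ.*-assoc g q D ⟩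
      g * (q * D) ∎)
      where open ≡-Reasoning
    q∣B : q ∣ B
    q∣B = coprime-divisor (⊥-sym (coprime-/gcd A C)) (divides D (trans rB≡qD (ℕ.*-comm q D)))
    B≡qs : B ≡ q * quotient q∣B
    B≡qs = m∣n⇒n≡m*quotient q∣B
    D≡rs : D ≡ r * quotient q∣B
    D≡rs = ℕ.*-cancelˡ-≡ D (r * quotient q∣B) q (begin
      q * D                    ≡⟨ sym rB≡qD ⟩
      r * B                    ≡⟨ cong (r *_) B≡qs ⟩
      r * (q * quotient q∣B)   ≡⟨ ℕ.*-comm r _ ⟩
      q * quotient q∣B * r     ≡⟨ ℕ.*-assoc q _ r ⟩
      q * (quotient q∣B * r)   ≡⟨ cong (q *_) (ℕ.*-comm _ r) ⟩
      q * (r * quotient q∣B)   ∎)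
      where open ≡-Reasoning

  gcd[κxy,κxz]≡κx : ∀ κ x {y z} → Coprime y z → gcd (κ * (x * y)) (κ * (x * z)) ≡ κ * x
  gcd[κxy,κxz]≡κx κ x {y} {z} y⊥z = begin
    gcd (κ * (x * y)) (κ * (x * z)) ≡⟨ sym (cong₂ gcd (ℕ.*-assoc κ x y) (ℕ.*-assoc κ x z)) ⟩
    gcd (κ * x * y) (κ * x * z)     ≡⟨ sym (c*gcd[m,n]≡gcd[cm,cn] (κ * x) y z) ⟩
    κ * x * gcd y z                 ≡⟨ cong (κ * x *_) (coprime⇒gcd≡1 y⊥z) ⟩
    κ * x * 1                       ≡⟨ ℕ.*-identityʳ (κ * x) ⟩
    κ * x                           ∎
    where open ≡-Reasoning

  record Splitting (κ E F G : ℕ) : Set where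
    field
      p q r s : ℕ
      F+1≡κpr : F + 1 ≡ κ * (p * r)
      F≡1+κqs : F ≡ suc (κ * (q * s))
      E≡κpq   : E ≡ κ * (p * q)
      G≡κrs   : G ≡ κ * (r * s)
      r⊥q     : Coprime r q
      p⊥s     : Coprime p s

    F∸1≡κqs : F ∸ 1 ≡ κ * (q * s)
    F∸1≡κqs = cong (_∸ 1) F≡1+κqs

    gcd[F+1,E]≡κp : gcd (F + 1) E ≡ κ * p
    gcd[F+1,E]≡κp = trans (cong₂ gcd F+1≡κpr E≡κpq) (gcd[κxy,κxz]≡κx κ p r⊥q)

    gcd[F∸1,E]≡κq : gcd (F ∸ 1) E ≡ κ * q
    gcd[F∸1,E]≡κq =
      trans (cong₂ gcd F∸1≡κqs (trans E≡κpq (cong (κ *_) (ℕ.*-comm p q))))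
            (gcd[κxy,κxz]≡κx κ q (⊥-sym p⊥s))

    gcd[F+1,G]≡κr : gcd (F + 1) G ≡ κ * r
    gcd[F+1,G]≡κr =
      trans (cong₂ gcd (trans F+1≡κpr (cong (κ *_) (ℕ.*-comm p r))) G≡κrs)
            (gcd[κxy,κxz]≡κx κ r p⊥s)

    gcd[F∸1,G]≡κs : gcd (F ∸ 1) G ≡ κ * s
    gcd[F∸1,G]≡κs =
      trans (cong₂ gcd (trans F∸1≡κqs (cong (κ *_) (ℕ.*-comm q s)))
                       (trans G≡κrs (cong (κ *_) (ℕ.*-comm r s))))
            (gcd[κxy,κxz]≡κx κ s (⊥-sym r⊥q))

    pq≢0 : 1 ℕ.≤ E → NonZero (p * q)
    pq≢0 E≥1 = m*n≢0⇒n≢0 κ {{>-nonZero (subst (1 ℕ.≤_) E≡κpq E≥1)}}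

    p≢0 : 1 ℕ.≤ E → NonZero p
    p≢0 E≥1 = m*n≢0⇒m≢0 p {{pq≢0 E≥1}}

    q≢0 : 1 ℕ.≤ E → NonZero q
    q≢0 E≥1 = m*n≢0⇒n≢0 p {{pq≢0 E≥1}}

  odd⇒≡1+2k : ∀ {m} → ¬ 2 ∣ m → Σ ℕ λ k → m ≡ suc (2 * k)
  odd⇒≡1+2k {m} 2∤m with m % 2 in m%2≡r | m≡m%n+[m/n]*n m 2 | m%n<n m 2
  ... | zero        | _          | _ = ⊥-elim (2∤m (m%n≡0⇒n∣m m 2 m%2≡r))
  ... | suc zero    | m≡1+[m/2]2 | _ = m / 2 , trans m≡1+[m/2]2 (cong suc (ℕ.*-comm (m / 2) 2))
  ... | suc (suc _) | _          | s≤s (s≤s ())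

  odd⇒2∣1+ : ∀ {m} → ¬ 2 ∣ m → 2 ∣ m + 1
  odd⇒2∣1+ 2∤m with odd⇒≡1+2k 2∤m
  ... | k , refl = divides (suc k) (odd+1 k)
    where
    odd+1 : ∀ k → suc (2 * k) + 1 ≡ suc k * 2
    odd+1 = solve-∀

  odd⇒2∣∸1 : ∀ {m} → ¬ 2 ∣ m → 2 ∣ m ∸ 1
  odd⇒2∣∸1 2∤m with odd⇒≡1+2k 2∤m
  ... | k , refl = divides k (ℕ.*-comm 2 k)

  2∤x⇒2∣xy⇒2∣y : ∀ {x y} → ¬ 2 ∣ x → 2 ∣ x * y → 2 ∣ y
  2∤x⇒2∣xy⇒2∣y {x} {y} 2∤x 2∣xy with euclidsLemma x y prime[2] 2∣xy
  ... | inj₁ 2∣x = ⊥-elim (2∤x 2∣x)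
  ... | inj₂ 2∣y = 2∣y

  splitting₁ : ∀ {E F G} → E * G + 1 ≡ F * F → ¬ 2 ∣ E → Splitting 1 E F G
  splitting₁ {E} {zero}   {G} det 2∤E = ⊥-elim (ℕ.m+1+n≢0 (E * G) det)
  splitting₁ {E} {suc F₀} {G} det 2∤E = record
    { p = p ; q = q ; r = r ; s = s
    ; F+1≡κpr = trans A≡pr (sym (ℕ.*-identityˡ _))
    ; F≡1+κqs = cong suc (trans B≡qs (sym (ℕ.*-identityˡ _)))
    ; E≡κpq   = trans C≡pq (sym (ℕ.*-identityˡ _))
    ; G≡κrs   = trans D≡rs (sym (ℕ.*-identityˡ _))
    ; r⊥q     = r⊥q
    ; p⊥s     = p⊥s
    }
    where
    instance
      E≢0 : NonZero E
      E≢0 = ≢-nonZero λ E≡0 → 2∤E (subst (2 ∣_) (sym E≡0) (2 ∣0))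
    [F+1][F-1]≡EG : (suc F₀ + 1) * F₀ ≡ E * G
    [F+1][F-1]≡EG = ℕ.+-cancelʳ-≡ 1 _ _ (trans (difference-of-squares F₀) (sym det))
      where
      difference-of-squares : ∀ F₀ → (suc F₀ + 1) * F₀ + 1 ≡ suc F₀ * suc F₀
      difference-of-squares = solve-∀
    open FourNumber (fourNumber (suc F₀ + 1) F₀ E G [F+1][F-1]≡EG)
    p⊥s : Coprime p s
    p⊥s {d} (d∣p , d∣s) with prime⇒irreducible prime[2] d∣2
      where
      d∣F₀+2 : d ∣ F₀ + 2
      d∣F₀+2 = subst (d ∣_) (trans (sym A≡pr) (sym (ℕ.+-suc F₀ 1))) (∣m⇒∣m*n r d∣p)
      d∣2 : d ∣ 2
      d∣2 = ∣m+n∣m⇒∣n d∣F₀+2 (subst (d ∣_) (sym B≡qs) (∣n⇒∣m*n q d∣s))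
    ... | inj₁ d≡1 = d≡1
    ... | inj₂ refl = ⊥-elim (2∤E (subst (2 ∣_) (sym C≡pq) (∣m⇒∣m*n q d∣p)))

  splitting₂ : ∀ {E F G} → E * G + 1 ≡ F * F → 1 ℕ.≤ E → ¬ 2 ∣ F → 2 ∣ E → 2 ∣ G → Splitting 2 E F G
  splitting₂ {F = F} det E≥1 2∤F (divides e refl) (divides g refl) with odd⇒≡1+2k 2∤F
  ... | k , refl = record
    { p = p ; q = q ; r = r ; s = s
    ; F+1≡κpr = trans (odd+1 k) (cong (2 *_) A≡pr)
    ; F≡1+κqs = cong (λ x → suc (2 * x)) B≡qs
    ; E≡κpq   = trans (ℕ.*-comm e 2) (cong (2 *_) C≡pq)
    ; G≡κrs   = trans (ℕ.*-comm g 2) (cong (2 *_) D≡rs)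
    ; r⊥q     = r⊥q
    ; p⊥s     = p⊥s
    }
    where
    odd+1 : ∀ k → suc (2 * k) + 1 ≡ 2 * suc k
    odd+1 = solve-∀
    instance
      e≢0 : NonZero e
      e≢0 = m*n≢0⇒m≢0 e {{>-nonZero E≥1}}
    [k+1]k≡eg : suc k * k ≡ e * g
    [k+1]k≡eg = ℕ.*-cancelˡ-≡ _ _ 4 (ℕ.+-cancelʳ-≡ 1 _ _ (begin
      4 * (suc k * k) + 1       ≡⟨ odd-square k ⟩
      suc (2 * k) * suc (2 * k) ≡⟨ sym det ⟩
      e * 2 * (g * 2) + 1       ≡⟨ cong (_+ 1) (four-times e g) ⟩
      4 * (e * g) + 1           ∎))
      where
      open ≡-Reasoning
      odd-square : ∀ k → 4 * (suc k * k) + 1 ≡ suc (2 * k) * suc (2 * k)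
      odd-square = solve-∀
      four-times : ∀ e g → e * 2 * (g * 2) ≡ 4 * (e * g)
      four-times = solve-∀
    open FourNumber (fourNumber (suc k) k e g [k+1]k≡eg)
    p⊥s : Coprime p s
    p⊥s {d} (d∣p , d∣s) = ∣1⇒≡1 (∣m+n∣m⇒∣n d∣k+1 (subst (d ∣_) (sym B≡qs) (∣n⇒∣m*n q d∣s)))
      where
      d∣k+1 : d ∣ k + 1
      d∣k+1 = subst (d ∣_) (trans (sym A≡pr) (ℕ.+-comm 1 k)) (∣m⇒∣m*n r d∣p)

module Factorisation
  (κ : ℕ) .{{_ : ℕ.NonZero κ}} (p q r s F w₁ w₂ : ℤ)
  (κpr≡F+1 : + κ ℤ.* (p ℤ.* r) ≡ F ℤ.+ ℤ.1ℤ) (κqs≡F-1 : + κ ℤ.* (q ℤ.* s) ≡ F ℤ.- ℤ.1ℤ)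
  (2w₁≡κs²[F+2] : + 2 ℤ.* w₁ ≡ + κ ℤ.* (s ℤ.* s ℤ.* (F ℤ.+ + 2)))
  (2w₂≡κr²[F-2] : + 2 ℤ.* w₂ ≡ + κ ℤ.* (r ℤ.* r ℤ.* (F ℤ.- + 2)))
  where

  open import Data.Integer using (_+_; _-_; _*_; -_; 1ℤ)
  open import Data.Integer.Properties using (*-cancelˡ-≡)
  open import Data.Integer.Tactic.RingSolver using (solve-∀)
  open import Relation.Binary.PropositionalEquality
  open ≡-Reasoning

  E G : ℤ
  E = + κ * (p * q)
  G = + κ * (r * s)

  X₁ X₂ : ℤ → ℤ
  X₁ t = p * p * t - w₁
  X₂ t = q * q * t - w₂

  κ[p²w₂+q²w₁]≡F³-3F : + κ * (p * p * w₂ + q * q * w₁) ≡ F * F * F - + 3 * F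
  κ[p²w₂+q²w₁]≡F³-3F = *-cancelˡ-≡ (+ 2) _ _ (begin
    + 2 * (+ κ * (p * p * w₂ + q * q * w₁))
      ≡⟨ expand (+ κ) p q w₁ w₂ ⟩
    p * p * (+ κ * (+ 2 * w₂)) + q * q * (+ κ * (+ 2 * w₁))
      ≡⟨ cong₂ (λ x y → p * p * (+ κ * x) + q * q * (+ κ * y)) 2w₂≡κr²[F-2] 2w₁≡κs²[F+2] ⟩
    p * p * (+ κ * (+ κ * (r * r * (F - + 2)))) + q * q * (+ κ * (+ κ * (s * s * (F + + 2))))
      ≡⟨ regroup (+ κ) p q r s F ⟩
    + κ * (p * r) * (+ κ * (p * r)) * (F - + 2) + + κ * (q * s) * (+ κ * (q * s)) * (F + + 2)
      ≡⟨ cong₂ (λ x y → x * x * (F - + 2) + y * y * (F + + 2)) κpr≡F+1 κqs≡F-1 ⟩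
    (F + 1ℤ) * (F + 1ℤ) * (F - + 2) + (F - 1ℤ) * (F - 1ℤ) * (F + + 2)
      ≡⟨ collect F ⟩
    + 2 * (F * F * F - + 3 * F) ∎)
    where
    expand : ∀ k p q w₁ w₂ → + 2 * (k * (p * p * w₂ + q * q * w₁))
                           ≡ p * p * (k * (+ 2 * w₂)) + q * q * (k * (+ 2 * w₁))
    expand = solve-∀
    regroup : ∀ k p q r s F →
              p * p * (k * (k * (r * r * (F - + 2)))) + q * q * (k * (k * (s * s * (F + + 2))))
              ≡ k * (p * r) * (k * (p * r)) * (F - + 2) + k * (q * s) * (k * (q * s)) * (F + + 2)
    regroup = solve-∀
    collect : ∀ F → (F + 1ℤ) * (F + 1ℤ) * (F - + 2) + (F - 1ℤ) * (F - 1ℤ) * (F + + 2)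
                  ≡ + 2 * (F * F * F - + 3 * F)
    collect = solve-∀

  4w₁w₂≡[F²-4]G² : + 4 * (w₁ * w₂) ≡ (F * F - + 4) * (G * G)
  4w₁w₂≡[F²-4]G² = begin
    + 4 * (w₁ * w₂)                                          ≡⟨ split w₁ w₂ ⟩
    (+ 2 * w₁) * (+ 2 * w₂)                                  ≡⟨ cong₂ _*_ 2w₁≡κs²[F+2] 2w₂≡κr²[F-2] ⟩
    + κ * (s * s * (F + + 2)) * (+ κ * (r * r * (F - + 2))) ≡⟨ regroup (+ κ) r s F ⟩
    (F * F - + 4) * (G * G)                                  ∎
    where
    split : ∀ x y → + 4 * (x * y) ≡ (+ 2 * x) * (+ 2 * y)
    split = solve-∀
    regroup : ∀ k r s F → k * (s * s * (F + + 2)) * (k * (r * r * (F - + 2)))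
                        ≡ (F * F - + 4) * (k * (r * s) * (k * (r * s)))
    regroup = solve-∀

  factorisation : ∀ a b c → + κ * (+ κ * a) ≡ E * E → + κ * b ≡ + 2 * F - E * F * G →
                  c ≡ w₁ * w₂ → ∀ t → a * t * t + b * t + c ≡ X₁ t * X₂ t
  factorisation a b c κ²a≡E² κb≡2F-EFG refl t = begin
    a * t * t + b * t + w₁ * w₂
      ≡⟨ cong₂ (λ x y → x * t * t + y * t + w₁ * w₂) a≡[pq]² b≡-[p²w₂+q²w₁] ⟩
    p * q * (p * q) * t * t + - (p * p * w₂ + q * q * w₁) * t + w₁ * w₂
      ≡⟨ factor p q t w₁ w₂ ⟩
    X₁ t * X₂ t ∎
    where
    factor : ∀ p q t w₁ w₂ → p * q * (p * q) * t * t + - (p * p * w₂ + q * q * w₁) * t + w₁ * w₂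
                           ≡ (p * p * t - w₁) * (q * q * t - w₂)
    factor = solve-∀
    a≡[pq]² : a ≡ p * q * (p * q)
    a≡[pq]² = *-cancelˡ-≡ (+ κ) _ _ (*-cancelˡ-≡ (+ κ) _ _ (trans κ²a≡E² (square (+ κ) (p * q))))
      where
      square : ∀ k x → k * x * (k * x) ≡ k * (k * (x * x))
      square = solve-∀
    b≡-[p²w₂+q²w₁] : b ≡ - (p * p * w₂ + q * q * w₁)
    b≡-[p²w₂+q²w₁] = *-cancelˡ-≡ (+ κ) _ _ (begin
      + κ * b                                     ≡⟨ κb≡2F-EFG ⟩
      + 2 * F - E * F * G                         ≡⟨ regroup (+ κ) p q r s F ⟩
      + 2 * F - F * (+ κ * (p * r)) * (+ κ * (q * s)) ≡⟨ cong₂ (λ x y → + 2 * F - F * x * y) κpr≡F+1 κqs≡F-1 ⟩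
      + 2 * F - F * (F + 1ℤ) * (F - 1ℤ)           ≡⟨ cubic F ⟩
      - (F * F * F - + 3 * F)                     ≡⟨ cong -_ (sym κ[p²w₂+q²w₁]≡F³-3F) ⟩
      - (+ κ * (p * p * w₂ + q * q * w₁))         ≡⟨ neg-inside (+ κ) (p * p * w₂ + q * q * w₁) ⟩
      + κ * - (p * p * w₂ + q * q * w₁)           ∎)
      where
      regroup : ∀ k p q r s F → + 2 * F - k * (p * q) * F * (k * (r * s))
                              ≡ + 2 * F - F * (k * (p * r)) * (k * (q * s))
      regroup = solve-∀
      cubic : ∀ F → + 2 * F - F * (F + 1ℤ) * (F - 1ℤ) ≡ - (F * F * F - + 3 * F)
      cubic = solve-∀
      neg-inside : ∀ k x → - (k * x) ≡ k * - x
      neg-inside = solve-∀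

  -- With μ = 2 − κ the right-hand sides below are manifestly non-negative when p, q, r, s, F
  -- and δ are natural numbers.
  module _ (μ : ℤ) (κ+μ≡2 : + κ + μ ≡ + 2) (t δ : ℤ) (tE≡FG+δ : t * E ≡ F * G + δ) where

    2-κ≡μ : + 2 - + κ ≡ μ
    2-κ≡μ = trans (cong (_- + κ) (sym κ+μ≡2)) (cancel (+ κ) μ)
      where
      cancel : ∀ k m → k + m - k ≡ m
      cancel = solve-∀

    2κqX₁≡2pδ+s[μF[F+1]+2κ] : + 2 * + κ * q * X₁ t ≡ + 2 * p * δ + s * (μ * F * (F + 1ℤ) + + 2 * + κ)
    2κqX₁≡2pδ+s[μF[F+1]+2κ] = begin
      + 2 * + κ * q * X₁ t
        ≡⟨ expand (+ κ) p q t w₁ ⟩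
      + 2 * p * (t * E) - + κ * q * (+ 2 * w₁)
        ≡⟨ cong₂ (λ x y → + 2 * p * x - + κ * q * y) tE≡FG+δ 2w₁≡κs²[F+2] ⟩
      + 2 * p * (F * G + δ) - + κ * q * (+ κ * (s * s * (F + + 2)))
        ≡⟨ regroup (+ κ) p q r s F δ ⟩
      + 2 * p * δ + s * (+ 2 * F * (+ κ * (p * r)) - + κ * (+ κ * (q * s)) * (F + + 2))
        ≡⟨ cong₂ (λ x y → + 2 * p * δ + s * (+ 2 * F * x - + κ * y * (F + + 2))) κpr≡F+1 κqs≡F-1 ⟩
      + 2 * p * δ + s * (+ 2 * F * (F + 1ℤ) - + κ * (F - 1ℤ) * (F + + 2))
        ≡⟨ collect (+ κ) p s F δ ⟩
      + 2 * p * δ + s * ((+ 2 - + κ) * F * (F + 1ℤ) + + 2 * + κ)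
        ≡⟨ cong (λ m → + 2 * p * δ + s * (m * F * (F + 1ℤ) + + 2 * + κ)) 2-κ≡μ ⟩
      + 2 * p * δ + s * (μ * F * (F + 1ℤ) + + 2 * + κ) ∎
      where
      expand : ∀ k p q t w₁ → + 2 * k * q * (p * p * t - w₁) ≡ + 2 * p * (t * (k * (p * q))) - k * q * (+ 2 * w₁)
      expand = solve-∀
      regroup : ∀ k p q r s F δ → + 2 * p * (F * (k * (r * s)) + δ) - k * q * (k * (s * s * (F + + 2)))
                                ≡ + 2 * p * δ + s * (+ 2 * F * (k * (p * r)) - k * (k * (q * s)) * (F + + 2))
      regroup = solve-∀
      collect : ∀ k p s F δ → + 2 * p * δ + s * (+ 2 * F * (F + 1ℤ) - k * (F - 1ℤ) * (F + + 2))
                            ≡ + 2 * p * δ + s * ((+ 2 - k) * F * (F + 1ℤ) + + 2 * k)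
      collect = solve-∀

    2κpX₂≡2qδ+r[μF[F-1]+2κ] : + 2 * + κ * p * X₂ t ≡ + 2 * q * δ + r * (μ * F * (F - 1ℤ) + + 2 * + κ)
    2κpX₂≡2qδ+r[μF[F-1]+2κ] = begin
      + 2 * + κ * p * X₂ t
        ≡⟨ expand (+ κ) p q t w₂ ⟩
      + 2 * q * (t * E) - + κ * p * (+ 2 * w₂)
        ≡⟨ cong₂ (λ x y → + 2 * q * x - + κ * p * y) tE≡FG+δ 2w₂≡κr²[F-2] ⟩
      + 2 * q * (F * G + δ) - + κ * p * (+ κ * (r * r * (F - + 2)))
        ≡⟨ regroup (+ κ) p q r s F δ ⟩
      + 2 * q * δ + r * (+ 2 * F * (+ κ * (q * s)) - + κ * (+ κ * (p * r)) * (F - + 2))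
        ≡⟨ cong₂ (λ x y → + 2 * q * δ + r * (+ 2 * F * x - + κ * y * (F - + 2))) κqs≡F-1 κpr≡F+1 ⟩
      + 2 * q * δ + r * (+ 2 * F * (F - 1ℤ) - + κ * (F + 1ℤ) * (F - + 2))
        ≡⟨ collect (+ κ) q r F δ ⟩
      + 2 * q * δ + r * ((+ 2 - + κ) * F * (F - 1ℤ) + + 2 * + κ)
        ≡⟨ cong (λ m → + 2 * q * δ + r * (m * F * (F - 1ℤ) + + 2 * + κ)) 2-κ≡μ ⟩
      + 2 * q * δ + r * (μ * F * (F - 1ℤ) + + 2 * + κ) ∎
      where
      expand : ∀ k p q t w₂ → + 2 * k * p * (q * q * t - w₂) ≡ + 2 * q * (t * (k * (p * q))) - k * p * (+ 2 * w₂)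
      expand = solve-∀
      regroup : ∀ k p q r s F δ → + 2 * q * (F * (k * (r * s)) + δ) - k * p * (k * (r * r * (F - + 2)))
                                ≡ + 2 * q * δ + r * (+ 2 * F * (k * (q * s)) - k * (k * (p * r)) * (F - + 2))
      regroup = solve-∀
      collect : ∀ k q r F δ → + 2 * q * δ + r * (+ 2 * F * (F - 1ℤ) - k * (F + 1ℤ) * (F - + 2))
                            ≡ + 2 * q * δ + r * ((+ 2 - k) * F * (F - 1ℤ) + + 2 * k)
      collect = solve-∀

module Arithmetic where

  open import Data.Nat using (zero; suc; NonZero)
  import Data.Nat.Properties as ℕ
  import Data.Nat.DivMod as ℕ
  open import Data.Nat.Divisibility using (divides)
  open import Data.Nat.Primality using (prime⇒irreducible)
  import Data.Sum as Sum
  open import Data.Integer using (-[1+_]; 0ℤ; 1ℤ; +≤+; +<+)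
  import Data.Integer.Properties as ℤ
  open import Data.Integer.DivMod using (_/_; _/ℕ_; div-pos-is-/ℕ)
  open import Relation.Binary.PropositionalEquality

  pos-*₃ : ∀ a b c → + (a ℕ.* b ℕ.* c) ≡ + a ℤ.* + b ℤ.* + c
  pos-*₃ a b c = trans (ℤ.pos-* (a ℕ.* b) c) (cong (ℤ._* + c) (ℤ.pos-* a b))

  pos-*-* : ∀ a b c → + (a ℕ.* (b ℕ.* c)) ≡ + a ℤ.* (+ b ℤ.* + c)
  pos-*-* a b c = trans (ℤ.pos-* a (b ℕ.* c)) (cong (+ a ℤ.*_) (ℤ.pos-* b c))

  pos-square : ∀ {x y} → x ≡ y → + (x ℕ.* x) ≡ + y ℤ.* + y
  pos-square {y = y} refl = ℤ.pos-* y y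

  [d*w]/d≡w : ∀ d w .{{_ : NonZero d}} → (+ d ℤ.* w) / + d ≡ w
  [d*w]/d≡w d@(suc _) (+ m) = begin
    (+ d ℤ.* + m) / + d ≡⟨ cong (_/ + d) (sym (ℤ.pos-* d m)) ⟩
    + (d ℕ.* m) / + d   ≡⟨ div-pos-is-/ℕ (+ (d ℕ.* m)) d ⟩
    + (d ℕ.* m ℕ./ d)   ≡⟨ cong +_ (trans (cong (ℕ._/ d) (ℕ.*-comm d m)) (ℕ.m*n/n≡m m d)) ⟩
    + m                 ∎
    where open ≡-Reasoning
  [d*w]/d≡w d@(suc d-1) -[1+ m ] =
    trans (div-pos-is-/ℕ -[1+ m ℕ.+ d-1 ℕ.* suc m ] d) quotient
    where
    -- _/ℕ_ on a negative dividend case-splits on the remainder, which is 0 here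
    x : ℕ
    x = m ℕ.+ d-1 ℕ.* suc m
    d∣1+x : suc x ℕ.% d ≡ 0
    d∣1+x = trans (cong (ℕ._% d) (ℕ.*-comm d (suc m))) (ℕ.m*n%n≡0 (suc m) d)
    quotient : -[1+ x ] /ℕ d ≡ -[1+ m ]
    quotient with suc x ℕ.% d | d∣1+x
    ... | zero | _ = cong (λ v → ℤ.- (+ v))
                          (trans (cong (ℕ._/ d) (ℕ.*-comm d (suc m))) (ℕ.m*n/n≡m (suc m) d))

  fdiv≡/ : ∀ m n .{{_ : NonZero n}} → fdiv m n ≡ m ℕ./ n
  fdiv≡/ m (suc n) = refl

  module _ (m o : ℕ) .{{_ : NonZero o}} where

    m/o<n⇒m<n*o : ∀ {n} → m ℕ./ o ℕ.< n → m ℕ.< n ℕ.* o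
    m/o<n⇒m<n*o {n} m/o<n = ℕ.≰⇒> λ no≤m →
      ℕ.<⇒≱ m/o<n (subst (ℕ._≤ m ℕ./ o) (ℕ.m*n/n≡m n o) (ℕ./-monoˡ-≤ o no≤m))

    n*o≤m+o⇒n≤1+m/o : ∀ n → n ℕ.* o ℕ.≤ m ℕ.+ o → n ℕ.≤ suc (m ℕ./ o)
    n*o≤m+o⇒n≤1+m/o zero    _      = ℕ.z≤n
    n*o≤m+o⇒n≤1+m/o (suc n) no≤m+o = ℕ.s≤s (ℕ.≮⇒≥ λ m/o<n →
      ℕ.<⇒≱ (ℕ.+-monoʳ-< o (m/o<n⇒m<n*o m/o<n)) (subst (suc n ℕ.* o ℕ.≤_) (ℕ.+-comm m o) no≤m+o))

  module _ (E F G : ℕ) .{{_ : NonZero E}} where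

    record AboveT₀ (t : ℤ) : Set where
      field
        n d       : ℕ
        t≡n       : t ≡ + n
        nE≡FG+1+d : n ℕ.* E ≡ F ℕ.* G ℕ.+ suc d

    above-t₀ : ∀ t → t₀ E F G ℤ.≤ t → AboveT₀ t
    above-t₀ (+ n) (+≤+ t₀≤n) with ℕ.m≤n⇒∃[o]m+o≡n (m/o<n⇒m<n*o (F ℕ.* G) E FG/E<n)
      where
      FG/E<n : F ℕ.* G ℕ./ E ℕ.< n
      FG/E<n = subst (ℕ._≤ n) (trans (ℕ.+-comm _ 1) (cong suc (fdiv≡/ (F ℕ.* G) E))) t₀≤n
    ... | d , FG+1+d≡nE = record
      { n = n ; d = d ; t≡n = refl ; nE≡FG+1+d = trans (sym FG+1+d≡nE) (sym (ℕ.+-suc (F ℕ.* G) d)) }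

    at-t₀ : ∀ t n d → t₀ E F G ℤ.≤ t → t ≡ + n → n ℕ.* E ≡ F ℕ.* G ℕ.+ suc d → suc d ℕ.≤ E →
            t ≡ t₀ E F G
    at-t₀ t n d t₀≤t refl nE≡FG+1+d 1+d≤E = ℤ.≤-antisym (+≤+ n≤t₀) t₀≤t
      where
      n≤t₀ : n ℕ.≤ fdiv (F ℕ.* G) E ℕ.+ 1
      n≤t₀ = subst (n ℕ.≤_) (trans (ℕ.+-comm 1 _) (cong (ℕ._+ 1) (sym (fdiv≡/ (F ℕ.* G) E))))
               (n*o≤m+o⇒n≤1+m/o (F ℕ.* G) E n
                 (subst (ℕ._≤ F ℕ.* G ℕ.+ E) (sym nE≡FG+1+d) (ℕ.+-monoʳ-≤ (F ℕ.* G) 1+d≤E)))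

  positive-multiple : ∀ m c d n {X} .{{_ : NonZero c}} → + m ℤ.* X ≡ + (c ℕ.* suc d ℕ.+ n) →
                      0ℤ ℤ.< X × (X ≡ 1ℤ → c ℕ.* suc d ℕ.≤ m)
  positive-multiple m c@(suc _) d n {X} mX≡ = 0<X , X≡1⇒
    where
    0<X : 0ℤ ℤ.< X
    0<X = ℤ.*-cancelˡ-<-nonNeg (+ m) (subst₂ ℤ._<_ (sym (ℤ.*-zeroʳ (+ m))) (sym mX≡) (+<+ ℕ.z<s))
    X≡1⇒ : X ≡ 1ℤ → c ℕ.* suc d ℕ.≤ m
    X≡1⇒ refl = subst (c ℕ.* suc d ℕ.≤_) (ℤ.+-injective (trans (sym mX≡) (ℤ.*-identityʳ (+ m))))
                      (ℕ.m≤m+n _ n)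

  positive-factors-of-prime : ∀ {X Y P} → Prime P → X ℤ.* Y ≡ + P → 0ℤ ℤ.< X → 0ℤ ℤ.< Y →
                              X ≡ 1ℤ ⊎ Y ≡ 1ℤ
  positive-factors-of-prime {+ suc a} {+ suc b} {P} prime-P XY≡P (+<+ _) (+<+ _) =
    Sum.map (cong +_) 1+b≡1 (prime⇒irreducible prime-P (divides (suc b) (trans (sym ab≡P) (ℕ.*-comm (suc a) (suc b)))))
    where
    ab≡P : suc a ℕ.* suc b ≡ P
    ab≡P = ℤ.+-injective (trans (ℤ.pos-* (suc a) (suc b)) XY≡P)
    1+b≡1 : suc a ≡ P → + suc b ≡ 1ℤ
    1+b≡1 1+a≡P = cong +_ (ℕ.*-cancelˡ-≡ (suc b) 1 (suc a)
      (trans ab≡P (trans (sym 1+a≡P) (sym (ℕ.*-identityʳ (suc a))))))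

  remainder-bound : ∀ κ p q d .{{_ : NonZero p}} → 2 ℕ.* p ℕ.* d ℕ.≤ 2 ℕ.* κ ℕ.* q → d ℕ.≤ κ ℕ.* (p ℕ.* q)
  remainder-bound κ p q d 2pd≤2κq = begin
    d             ≤⟨ ℕ.m≤n*m d p ⟩
    p ℕ.* d       ≤⟨ ℕ.*-cancelˡ-≤ 2 (subst₂ ℕ._≤_ (ℕ.*-assoc 2 p d) (ℕ.*-assoc 2 κ q) 2pd≤2κq) ⟩
    κ ℕ.* q       ≤⟨ ℕ.*-monoʳ-≤ κ (ℕ.m≤n*m q p) ⟩
    κ ℕ.* (p ℕ.* q) ∎
    where open ℕ.≤-Reasoning

open MatrixProducts using (palindrome-det; prodM-e-positive)
open Splittings
open Arithmetic

Factorises : (E F G : ℕ) (D Y₁ Y₂ : ℤ → ℤ) → Set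
Factorises E F G D Y₁ Y₂ =
  (∀ t → D t ≡ Y₁ t ℤ.* Y₂ t)
  × (∀ t → t₀ E F G ℤ.≤ t → + 0 ℤ.< Y₁ t × + 0 ℤ.< Y₂ t)
  × (∀ t → t₀ E F G ℤ.≤ t → (p : ℕ) → Prime p → D t ≡ + p → t ≡ t₀ E F G)

module FromSplitting
  {κ μ E F G : ℕ} .{{_ : ℕ.NonZero κ}} (κ+μ≡2 : κ ℕ.+ μ ≡ 2) (S : Splitting κ E F G) (E≥1 : 1 ℕ.≤ E)
  (w₁ w₂ : ℤ)
  (2w₁≡κs²[F+2] : + 2 ℤ.* w₁ ≡ + κ ℤ.* (+ Splitting.s S ℤ.* + Splitting.s S ℤ.* (+ F ℤ.+ + 2)))
  (2w₂≡κr²[F-2] : + 2 ℤ.* w₂ ≡ + κ ℤ.* (+ Splitting.r S ℤ.* + Splitting.r S ℤ.* (+ F ℤ.- + 2)))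
  where

  open import Data.Nat using (suc; NonZero; >-nonZero)
  import Data.Nat.Properties as ℕ
  open import Data.Integer using (1ℤ)
  import Data.Integer.Properties as ℤ
  open import Data.Product using (proj₁; proj₂)
  open import Data.Sum using ([_,_]′)
  open import Relation.Binary.PropositionalEquality

  open Splitting S

  instance
    _ : NonZero E
    _ = >-nonZero E≥1
    _ : NonZero p
    _ = p≢0 E≥1
    _ : NonZero q
    _ = q≢0 E≥1

  +[F∸1]≡F-1 : + (F ℕ.∸ 1) ≡ + F ℤ.- 1ℤ
  +[F∸1]≡F-1 = subst (λ F → + (F ℕ.∸ 1) ≡ + F ℤ.- 1ℤ) (sym F≡1+κqs) refl

  κpr≡F+1 : + κ ℤ.* (+ p ℤ.* + r) ≡ + F ℤ.+ 1ℤ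
  κpr≡F+1 = sym (trans (cong +_ F+1≡κpr) (pos-*-* κ p r))

  κqs≡F-1 : + κ ℤ.* (+ q ℤ.* + s) ≡ + F ℤ.- 1ℤ
  κqs≡F-1 = sym (trans (sym +[F∸1]≡F-1) (trans (cong +_ F∸1≡κqs) (pos-*-* κ q s)))

  open Factorisation κ (+ p) (+ q) (+ r) (+ s) (+ F) w₁ w₂ κpr≡F+1 κqs≡F-1 2w₁≡κs²[F+2] 2w₂≡κr²[F-2]
    public renaming (E to Eℤ; G to Gℤ)

  +E≡Eℤ : + E ≡ Eℤ
  +E≡Eℤ = trans (cong +_ E≡κpq) (pos-*-* κ p q)

  +G≡Gℤ : + G ≡ Gℤ
  +G≡Gℤ = trans (cong +_ G≡κrs) (pos-*-* κ r s)

  cc≡w₁w₂ : cc E F G ≡ w₁ ℤ.* w₂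
  cc≡w₁w₂ = begin
    ((+ F ℤ.* + F ℤ.- + 4) ℤ.* (+ G ℤ.* + G)) ℤ./ + 4 ≡⟨ cong (λ g → ((+ F ℤ.* + F ℤ.- + 4) ℤ.* (g ℤ.* g)) ℤ./ + 4) +G≡Gℤ ⟩
    ((+ F ℤ.* + F ℤ.- + 4) ℤ.* (Gℤ ℤ.* Gℤ)) ℤ./ + 4   ≡⟨ cong (ℤ._/ + 4) (sym 4w₁w₂≡[F²-4]G²) ⟩
    (+ 4 ℤ.* (w₁ ℤ.* w₂)) ℤ./ + 4                     ≡⟨ [d*w]/d≡w 4 (w₁ ℤ.* w₂) ⟩
    w₁ ℤ.* w₂                                       ∎
    where open ≡-Reasoning

  module _ (t : ℤ) (t₀≤t : t₀ E F G ℤ.≤ t) where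

    open AboveT₀ (above-t₀ E F G t t₀≤t)

    tEℤ≡FGℤ+δ : t ℤ.* Eℤ ≡ + F ℤ.* Gℤ ℤ.+ + suc d
    tEℤ≡FGℤ+δ = begin
      t ℤ.* Eℤ                  ≡⟨ cong₂ ℤ._*_ t≡n (sym +E≡Eℤ) ⟩
      + n ℤ.* + E               ≡⟨ sym (ℤ.pos-* n E) ⟩
      + (n ℕ.* E)               ≡⟨ cong +_ nE≡FG+1+d ⟩
      + (F ℕ.* G) ℤ.+ + suc d   ≡⟨ cong (ℤ._+ + suc d) (trans (ℤ.pos-* F G) (cong (+ F ℤ.*_) +G≡Gℤ)) ⟩
      + F ℤ.* Gℤ ℤ.+ + suc d    ∎
      where open ≡-Reasoning

    X₁-facts : ℤ.0ℤ ℤ.< X₁ t × (X₁ t ≡ 1ℤ → suc d ℕ.≤ E)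
    X₁-facts with positive-multiple (2 ℕ.* κ ℕ.* q) (2 ℕ.* p) d (s ℕ.* (μ ℕ.* F ℕ.* (F ℕ.+ 1) ℕ.+ 2 ℕ.* κ))
                    {{ℕ.m*n≢0 2 p}} scaled
      where
      scaled : + (2 ℕ.* κ ℕ.* q) ℤ.* X₁ t ≡ + (2 ℕ.* p ℕ.* suc d ℕ.+ s ℕ.* (μ ℕ.* F ℕ.* (F ℕ.+ 1) ℕ.+ 2 ℕ.* κ))
      scaled = begin
        + (2 ℕ.* κ ℕ.* q) ℤ.* X₁ t
          ≡⟨ cong (ℤ._* X₁ t) (pos-*₃ 2 κ q) ⟩
        + 2 ℤ.* + κ ℤ.* + q ℤ.* X₁ t
          ≡⟨ 2κqX₁≡2pδ+s[μF[F+1]+2κ] (+ μ) (cong +_ κ+μ≡2) t (+ suc d) tEℤ≡FGℤ+δ ⟩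
        + 2 ℤ.* + p ℤ.* + suc d ℤ.+ + s ℤ.* (+ μ ℤ.* + F ℤ.* (+ F ℤ.+ 1ℤ) ℤ.+ + 2 ℤ.* + κ)
          ≡⟨ sym (cong₂ ℤ._+_ (pos-*₃ 2 p (suc d))
                 (trans (ℤ.pos-* s _) (cong (+ s ℤ.*_) (cong₂ ℤ._+_ (pos-*₃ μ F (F ℕ.+ 1)) (ℤ.pos-* 2 κ))))) ⟩
        + (2 ℕ.* p ℕ.* suc d ℕ.+ s ℕ.* (μ ℕ.* F ℕ.* (F ℕ.+ 1) ℕ.+ 2 ℕ.* κ)) ∎
        where open ≡-Reasoning
    ... | 0<X₁ , X₁≡1⇒ = 0<X₁ , λ X₁≡1 → subst (suc d ℕ.≤_) (sym E≡κpq) (remainder-bound κ p q (suc d) (X₁≡1⇒ X₁≡1))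

    X₂-facts : ℤ.0ℤ ℤ.< X₂ t × (X₂ t ≡ 1ℤ → suc d ℕ.≤ E)
    X₂-facts with positive-multiple (2 ℕ.* κ ℕ.* p) (2 ℕ.* q) d (r ℕ.* (μ ℕ.* F ℕ.* (F ℕ.∸ 1) ℕ.+ 2 ℕ.* κ))
                    {{ℕ.m*n≢0 2 q}} scaled
      where
      scaled : + (2 ℕ.* κ ℕ.* p) ℤ.* X₂ t ≡ + (2 ℕ.* q ℕ.* suc d ℕ.+ r ℕ.* (μ ℕ.* F ℕ.* (F ℕ.∸ 1) ℕ.+ 2 ℕ.* κ))
      scaled = begin
        + (2 ℕ.* κ ℕ.* p) ℤ.* X₂ t
          ≡⟨ cong (ℤ._* X₂ t) (pos-*₃ 2 κ p) ⟩
        + 2 ℤ.* + κ ℤ.* + p ℤ.* X₂ t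
          ≡⟨ 2κpX₂≡2qδ+r[μF[F-1]+2κ] (+ μ) (cong +_ κ+μ≡2) t (+ suc d) tEℤ≡FGℤ+δ ⟩
        + 2 ℤ.* + q ℤ.* + suc d ℤ.+ + r ℤ.* (+ μ ℤ.* + F ℤ.* (+ F ℤ.- 1ℤ) ℤ.+ + 2 ℤ.* + κ)
          ≡⟨ sym (cong₂ ℤ._+_ (pos-*₃ 2 q (suc d))
                 (trans (ℤ.pos-* r _) (cong (+ r ℤ.*_) (cong₂ ℤ._+_
                   (trans (pos-*₃ μ F (F ℕ.∸ 1)) (cong (+ μ ℤ.* + F ℤ.*_) +[F∸1]≡F-1)) (ℤ.pos-* 2 κ))))) ⟩
        + (2 ℕ.* q ℕ.* suc d ℕ.+ r ℕ.* (μ ℕ.* F ℕ.* (F ℕ.∸ 1) ℕ.+ 2 ℕ.* κ)) ∎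
        where open ≡-Reasoning
    ... | 0<X₂ , X₂≡1⇒ = 0<X₂ , λ X₂≡1 →
      subst (suc d ℕ.≤_) (trans (cong (κ ℕ.*_) (ℕ.*-comm q p)) (sym E≡κpq))
            (remainder-bound κ q p (suc d) (X₂≡1⇒ X₂≡1))

    prime⇒t≡t₀ : ∀ P → Prime P → X₁ t ℤ.* X₂ t ≡ + P → t ≡ t₀ E F G
    prime⇒t≡t₀ P prime-P X₁X₂≡P = at-t₀ E F G t n d t₀≤t t≡n nE≡FG+1+d
      ([ proj₂ X₁-facts , proj₂ X₂-facts ]′
         (positive-factors-of-prime prime-P X₁X₂≡P (proj₁ X₁-facts) (proj₁ X₂-facts)))

  factorises : ∀ a b {Y₁ Y₂} → + κ ℤ.* (+ κ ℤ.* a) ≡ + E ℤ.* + E →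
               + κ ℤ.* b ≡ + 2 ℤ.* + F ℤ.- + E ℤ.* + F ℤ.* + G →
               (∀ t → Y₁ t ≡ X₁ t) → (∀ t → Y₂ t ≡ X₂ t) →
               Factorises E F G (λ t → a ℤ.* t ℤ.* t ℤ.+ b ℤ.* t ℤ.+ cc E F G) Y₁ Y₂
  factorises a b {Y₁} {Y₂} κ²a≡E² κb≡2F-EFG Y₁≗X₁ Y₂≗X₂ =
    (λ t → trans (D≡X₁X₂ t) (sym (Y₁Y₂≡X₁X₂ t))) ,
    (λ t t₀≤t → subst (ℤ.0ℤ ℤ.<_) (sym (Y₁≗X₁ t)) (proj₁ (X₁-facts t t₀≤t)) ,
                subst (ℤ.0ℤ ℤ.<_) (sym (Y₂≗X₂ t)) (proj₁ (X₂-facts t t₀≤t))) ,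
    (λ t t₀≤t P prime-P D≡P → prime⇒t≡t₀ t t₀≤t P prime-P (trans (sym (D≡X₁X₂ t)) D≡P))
    where
    D≡X₁X₂ : ∀ t → a ℤ.* t ℤ.* t ℤ.+ b ℤ.* t ℤ.+ cc E F G ≡ X₁ t ℤ.* X₂ t
    D≡X₁X₂ = factorisation a b (cc E F G)
      (subst (λ e → + κ ℤ.* (+ κ ℤ.* a) ≡ e ℤ.* e) +E≡Eℤ κ²a≡E²)
      (subst₂ (λ e g → + κ ℤ.* b ≡ + 2 ℤ.* + F ℤ.- e ℤ.* + F ℤ.* g) +E≡Eℤ +G≡Gℤ κb≡2F-EFG)
      cc≡w₁w₂
    Y₁Y₂≡X₁X₂ : ∀ t → Y₁ t ℤ.* Y₂ t ≡ X₁ t ℤ.* X₂ t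
    Y₁Y₂≡X₁X₂ t = cong₂ ℤ._*_ (Y₁≗X₁ t) (Y₂≗X₂ t)

module Case₁ {E F G : ℕ} (det : E ℕ.* G ℕ.+ 1 ≡ F ℕ.* F) (E≥1 : 1 ℕ.≤ E) (2∤E : ¬ 2 ∣ E) where

  import Data.Nat.Properties as ℕ
  open import Data.Nat.Divisibility using (_∣?_; ∣m⇒∣m*n; ∣n⇒∣m*n)
  import Data.Integer.Properties as ℤ
  import Data.Integer.Divisibility.Signed as ℤS
  open import Relation.Nullary using (yes; no)
  open import Relation.Binary.PropositionalEquality

  S : Splitting 1 E F G
  S = splitting₁ det 2∤E

  open Splitting S

  2∣F⊎2∣r×2∣s : 2 ∣ F ⊎ (2 ∣ r × 2 ∣ s)
  2∣F⊎2∣r×2∣s with 2 ∣? F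
  ... | yes 2∣F = inj₁ 2∣F
  ... | no 2∤F  = inj₂ (2∤x⇒2∣xy⇒2∣y 2∤p (subst (2 ∣_) (trans F+1≡κpr (ℕ.*-identityˡ _)) (odd⇒2∣1+ 2∤F)) ,
                        2∤x⇒2∣xy⇒2∣y 2∤q (subst (2 ∣_) (trans F∸1≡κqs (ℕ.*-identityˡ _)) (odd⇒2∣∸1 2∤F)))
    where
    2∤pq : ¬ 2 ∣ p ℕ.* q
    2∤pq 2∣pq = 2∤E (subst (2 ∣_) (trans (sym (ℕ.*-identityˡ _)) (sym E≡κpq)) 2∣pq)
    2∤p : ¬ 2 ∣ p
    2∤p 2∣p = 2∤pq (∣m⇒∣m*n q 2∣p)
    2∤q : ¬ 2 ∣ q
    2∤q 2∣q = 2∤pq (∣n⇒∣m*n p 2∣q)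

  G₋≡s : G₋₁ E F G ≡ s
  G₋≡s = trans gcd[F∸1,G]≡κs (ℕ.*-identityˡ s)

  G₊≡r : G₊₁ E F G ≡ r
  G₊≡r = trans gcd[F+1,G]≡κr (ℕ.*-identityˡ r)

  N₁≡s²[F+2] : N₁ E F G ≡ + s ℤ.* + s ℤ.* (+ F ℤ.+ + 2)
  N₁≡s²[F+2] = cong (ℤ._* (+ F ℤ.+ + 2)) (pos-square G₋≡s)

  N₂≡r²[F-2] : N₂ E F G ≡ + r ℤ.* + r ℤ.* (+ F ℤ.- + 2)
  N₂≡r²[F-2] = cong (ℤ._* (+ F ℤ.- + 2)) (pos-square G₊≡r)

  2∣N₁ : + 2 ℤS.∣ N₁ E F G
  2∣N₁ = subst (+ 2 ℤS.∣_) (sym N₁≡s²[F+2]) (even 2∣F⊎2∣r×2∣s)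
    where
    even : 2 ∣ F ⊎ (2 ∣ r × 2 ∣ s) → + 2 ℤS.∣ + s ℤ.* + s ℤ.* (+ F ℤ.+ + 2)
    even (inj₁ 2∣F)       = ℤS.∣n⇒∣m*n (+ s ℤ.* + s) (ℤS.∣m∣n⇒∣m+n (ℤS.∣ᵤ⇒∣ {+ 2} {+ F} 2∣F) ℤS.∣-refl)
    even (inj₂ (_ , 2∣s)) = ℤS.∣m⇒∣m*n (+ F ℤ.+ + 2) (ℤS.∣m⇒∣m*n (+ s) (ℤS.∣ᵤ⇒∣ {+ 2} {+ s} 2∣s))

  2∣N₂ : + 2 ℤS.∣ N₂ E F G
  2∣N₂ = subst (+ 2 ℤS.∣_) (sym N₂≡r²[F-2]) (even 2∣F⊎2∣r×2∣s)
    where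
    even : 2 ∣ F ⊎ (2 ∣ r × 2 ∣ s) → + 2 ℤS.∣ + r ℤ.* + r ℤ.* (+ F ℤ.- + 2)
    even (inj₁ 2∣F)       = ℤS.∣n⇒∣m*n (+ r ℤ.* + r) (ℤS.∣m∣n⇒∣m-n (ℤS.∣ᵤ⇒∣ {+ 2} {+ F} 2∣F) ℤS.∣-refl)
    even (inj₂ (2∣r , _)) = ℤS.∣m⇒∣m*n (+ F ℤ.- + 2) (ℤS.∣m⇒∣m*n (+ r) (ℤS.∣ᵤ⇒∣ {+ 2} {+ r} 2∣r))

  half : ∀ {N} → + 2 ℤS.∣ N → ℤ
  half = ℤS.quotient

  2*half≡ : ∀ {N} (2∣N : + 2 ℤS.∣ N) → + 2 ℤ.* half 2∣N ≡ N
  2*half≡ 2∣N = trans (ℤ.*-comm (+ 2) _) (sym (ℤS._∣_.equality 2∣N))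

  N/2≡half : ∀ {N} (2∣N : + 2 ℤS.∣ N) → N ℤ./ + 2 ≡ half 2∣N
  N/2≡half 2∣N = trans (cong (ℤ._/ + 2) (sym (2*half≡ 2∣N))) ([d*w]/d≡w 2 _)

  open FromSplitting {μ = 1} refl S E≥1 (half 2∣N₁) (half 2∣N₂)
    (trans (2*half≡ 2∣N₁) (trans N₁≡s²[F+2] (sym (ℤ.*-identityˡ _))))
    (trans (2*half≡ 2∣N₂) (trans N₂≡r²[F-2] (sym (ℤ.*-identityˡ _))))

  P₁≗X₁ : ∀ t → P₁ E F G t ≡ X₁ t
  P₁≗X₁ t = cong₂ (λ x y → x ℤ.* t ℤ.- y) (pos-square (trans gcd[F+1,E]≡κp (ℕ.*-identityˡ p))) (N/2≡half 2∣N₁)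

  P₂≗X₂ : ∀ t → P₂ E F G t ≡ X₂ t
  P₂≗X₂ t = cong₂ (λ x y → x ℤ.* t ℤ.- y) (pos-square (trans gcd[F∸1,E]≡κq (ℕ.*-identityˡ q))) (N/2≡half 2∣N₂)

  conclusion : (+ 2 ℤD.∣ N₁ E F G) × (+ 2 ℤD.∣ N₂ E F G) × Factorises E F G (D₁ E F G) (P₁ E F G) (P₂ E F G)
  conclusion = ℤS.∣⇒∣ᵤ 2∣N₁ , ℤS.∣⇒∣ᵤ 2∣N₂ , factorises (a₁ E F G) (b₁ E F G)
    (trans (ℤ.*-identityˡ _) (trans (ℤ.*-identityˡ _) (ℤ.pos-* E E)))
    (trans (ℤ.*-identityˡ _) (cong₂ ℤ._-_ (ℤ.pos-* 2 F) (pos-*₃ E F G)))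
    P₁≗X₁ P₂≗X₂

module Case₂ {E F G : ℕ} (det : E ℕ.* G ℕ.+ 1 ≡ F ℕ.* F) (E≥1 : 1 ℕ.≤ E)
  (2∤F : ¬ 2 ∣ F) (2∣E : 2 ∣ E) (2∣G : 2 ∣ G) where

  import Data.Nat.Properties as ℕ
  import Data.Nat.DivMod as ℕ
  open import Data.Nat.Divisibility using (∣m⇒∣m*n; *-pres-∣)
  import Data.Integer.Properties as ℤ
  open import Relation.Binary.PropositionalEquality

  S : Splitting 2 E F G
  S = splitting₂ det E≥1 2∤F 2∣E 2∣G

  open Splitting S

  open FromSplitting {μ = 0} refl S E≥1 (+ s ℤ.* + s ℤ.* (+ F ℤ.+ + 2)) (+ r ℤ.* + r ℤ.* (+ F ℤ.- + 2)) refl refl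

  [2*m]/2≡m : ∀ m → 2 ℕ.* m ℕ./ 2 ≡ m
  [2*m]/2≡m m = trans (cong (ℕ._/ 2) (ℕ.*-comm 2 m)) (ℕ.m*n/n≡m m 2)

  Q₁≗X₁ : ∀ t → Q₁ E F G t ≡ X₁ t
  Q₁≗X₁ t = cong₂ (λ x y → x ℤ.* t ℤ.- y ℤ.* (+ F ℤ.+ + 2))
    (pos-square (trans (cong (ℕ._/ 2) gcd[F+1,E]≡κp) ([2*m]/2≡m p)))
    (pos-square (trans (cong (ℕ._/ 2) gcd[F∸1,G]≡κs) ([2*m]/2≡m s)))

  Q₂≗X₂ : ∀ t → Q₂ E F G t ≡ X₂ t
  Q₂≗X₂ t = cong₂ (λ x y → x ℤ.* t ℤ.- y ℤ.* (+ F ℤ.- + 2))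
    (pos-square (trans (cong (ℕ._/ 2) gcd[F∸1,E]≡κq) ([2*m]/2≡m q)))
    (pos-square (trans (cong (ℕ._/ 2) gcd[F+1,G]≡κr) ([2*m]/2≡m r)))

  4a≡E² : + 2 ℤ.* (+ 2 ℤ.* a₂ E F G) ≡ + E ℤ.* + E
  4a≡E² = begin
    + 2 ℤ.* (+ 2 ℤ.* + (E ℕ.* E ℕ./ 4)) ≡⟨ sym (pos-*-* 2 2 (E ℕ.* E ℕ./ 4)) ⟩
    + (2 ℕ.* (2 ℕ.* (E ℕ.* E ℕ./ 4)))   ≡⟨ cong +_ (sym (ℕ.*-assoc 2 2 (E ℕ.* E ℕ./ 4))) ⟩
    + (4 ℕ.* (E ℕ.* E ℕ./ 4))           ≡⟨ cong +_ (ℕ.m*[n/m]≡n (*-pres-∣ 2∣E 2∣E)) ⟩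
    + (E ℕ.* E)                         ≡⟨ ℤ.pos-* E E ⟩
    + E ℤ.* + E                         ∎
    where open ≡-Reasoning

  2b≡2F-EFG : + 2 ℤ.* b₂ E F G ≡ + 2 ℤ.* + F ℤ.- + E ℤ.* + F ℤ.* + G
  2b≡2F-EFG = begin
    + 2 ℤ.* (+ F ℤ.- + (E ℕ.* F ℕ.* G ℕ./ 2))        ≡⟨ ℤ.*-distribˡ-+ (+ 2) (+ F) _ ⟩
    + 2 ℤ.* + F ℤ.+ + 2 ℤ.* (ℤ.- + (E ℕ.* F ℕ.* G ℕ./ 2)) ≡⟨ cong (λ x → + 2 ℤ.* + F ℤ.+ x) (sym (ℤ.neg-distribʳ-* (+ 2) _)) ⟩
    + 2 ℤ.* + F ℤ.- + 2 ℤ.* + (E ℕ.* F ℕ.* G ℕ./ 2)  ≡⟨ cong (λ x → + 2 ℤ.* + F ℤ.- x) (sym (ℤ.pos-* 2 (E ℕ.* F ℕ.* G ℕ./ 2))) ⟩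
    + 2 ℤ.* + F ℤ.- + (2 ℕ.* (E ℕ.* F ℕ.* G ℕ./ 2))  ≡⟨ cong (λ x → + 2 ℤ.* + F ℤ.- + x) (ℕ.m*[n/m]≡n 2∣EFG) ⟩
    + 2 ℤ.* + F ℤ.- + (E ℕ.* F ℕ.* G)                ≡⟨ cong (λ x → + 2 ℤ.* + F ℤ.- x) (pos-*₃ E F G) ⟩
    + 2 ℤ.* + F ℤ.- + E ℤ.* + F ℤ.* + G              ∎
    where
    open ≡-Reasoning
    2∣EFG : 2 ∣ E ℕ.* F ℕ.* G
    2∣EFG = ∣m⇒∣m*n G (∣m⇒∣m*n F 2∣E)

  conclusion : Factorises E F G (D₂ E F G) (Q₁ E F G) (Q₂ E F G)
  conclusion = factorises (a₂ E F G) (b₂ E F G) 4a≡E² 2b≡2F-EFG Q₁≗X₁ Q₂≗X₂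

theorem6p2 :
    (l : ℕ) → 2 ℕ.≤ l → 2 ∣ l →
    (a : Fin (l ℕ.∸ 1) → ℕ) →
    (∀ i → 1 ℕ.≤ a i) →
    (∀ i → a i ≡ a (opposite i)) →
    let E = M2.e (prodM a)
        F = M2.f (prodM a)
        G = M2.g (prodM a)
    in (2 ∣ F ⊎ 2 ∣ G) →
       -- case (1)
       (((2 ∣ F × ¬ 2 ∣ E × ¬ 2 ∣ G) ⊎ (¬ 2 ∣ E × ¬ 2 ∣ F × 2 ∣ G)) →
          (+ 2 ℤD.∣ N₁ E F G) × (+ 2 ℤD.∣ N₂ E F G)
          × (∀ t → D₁ E F G t ≡ P₁ E F G t ℤ.* P₂ E F G t)
          × (∀ t → t₀ E F G ℤ.≤ t → + 0 ℤ.< P₁ E F G t × + 0 ℤ.< P₂ E F G t)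
          × (∀ t → t₀ E F G ℤ.≤ t → (p : ℕ) → Prime p → D₁ E F G t ≡ + p →
               t ≡ t₀ E F G))
       ×
       -- case (2)
       ((¬ 2 ∣ F × 2 ∣ E × 2 ∣ G) →
          (∀ t → D₂ E F G t ≡ Q₁ E F G t ℤ.* Q₂ E F G t)
          × (∀ t → t₀ E F G ℤ.≤ t → + 0 ℤ.< Q₁ E F G t × + 0 ℤ.< Q₂ E F G t)
          × (∀ t → t₀ E F G ℤ.≤ t → (p : ℕ) → Prime p → D₂ E F G t ≡ + p →
               t ≡ t₀ E F G))
-- The hypothesis 2 ∣ F ⊎ 2 ∣ G follows from the parity assumptions of either case.
theorem6p2 l 2≤l 2∣l a a≥1 a-palindrome _ =
  (λ where
    (inj₁ (_ , 2∤E , _)) → Case₁.conclusion det E≥1 2∤E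
    (inj₂ (2∤E , _ , _)) → Case₁.conclusion det E≥1 2∤E) ,
  (λ where
    (2∤F , 2∣E , 2∣G) → Case₂.conclusion det E≥1 2∤F 2∣E 2∣G)
  where
  det : M2.e (prodM a) ℕ.* M2.g (prodM a) ℕ.+ 1 ≡ M2.f (prodM a) ℕ.* M2.f (prodM a)
  det = palindrome-det l 2≤l 2∣l a a-palindrome
  E≥1 : 1 ℕ.≤ M2.e (prodM a)
  E≥1 = prodM-e-positive (l ℕ.∸ 1) a a≥1
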